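{- Let $t\geq 1$ and $k\geq 2t$ be integers and $s=k-2t+2$. The largest matrix representing a crown graph that is a submatrix of the Kneser matrix $KG_{k,t}$ is of size $s\times s$; that is, the maximum $\ell$ such that $KG_{k,t}$ has an $\ell\times\ell$ submatrix equal to $J_\ell-I_\ell$ is $s$.
   Context: $[k]=\{1,\dots,k\}$. The Kneser matrix $KG_{k,t}$ is the Boolean matrix with rows and columns indexed by all $t$-subsets of $[k]$, with entry $1$ at $(x,y)$ iff $x\cap y=\emptyset$ (the adjacency matrix of the Kneser graph). A submatrix is obtained by choosing lists of distinct row indices and distinct column indices. The matrix representing a crown graph of size $\ell\times\ell$ is $J_\ell-I_\ell$, where $J_\ell$ is the all-ones and $I_\ell$ the identity $\ell\times\ell$ matrix (ones exactly off the diagonal). -}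

module Defs where

open import Data.Nat using (ℕ)
open import Data.Bool using (Bool; true; false)
open import Data.Bool.Properties using () renaming (_≟_ to _≟B_)
open import Data.Fin using (Fin)
open import Data.Fin.Subset using (Subset; _∩_; ∣_∣; ⊥)
open import Data.Vec.Properties using (≡-dec)
open import Data.Product using (Σ; _,_; proj₁)
open import Relation.Nullary using (yes; no)
open import Relation.Binary.PropositionalEquality using (_≡_; _≢_)
open import Function.Definitions using (Injective)

TSubset : ℕ → ℕ → Set
TSubset k t = Σ (Subset k) (λ x → ∣ x ∣ ≡ t)

KG : (k t : ℕ) → TSubset k t → TSubset k t → Bool
KG k t (x , _) (y , _) with ≡-dec _≟B_ (x ∩ y) ⊥
... | yes _ = true
... | no _ = false

crown : (ℓ : ℕ) → Fin ℓ → Fin ℓ → Bool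
crown ℓ i j with i Data.Fin.≟ j
... | yes _ = false
... | no _ = true

HasCrownSubmatrix : (k t ℓ : ℕ) → Set
HasCrownSubmatrix k t ℓ =
  Σ (Fin ℓ → TSubset k t) λ r →
  Σ (Fin ℓ → TSubset k t) λ c →
  Injective _≡_ _≡_ r Data.Product.×
  Injective _≡_ _≡_ c Data.Product.×
  (∀ i j → KG k t (r i) (c j) ≡ crown ℓ i j)

-- An ℓ×ℓ crown submatrix of KG_{k,t} is a pair of families of t-sets A_i, B_j with
-- A_i ∩ B_j = ∅ exactly when i ≠ j. Choosing x_i ∈ A_i ∩ B_i gives distinct points,
-- and for i ≥ 2 the point x_i avoids A_0 ∪ B_1, which has 2t elements since A_0 and
-- B_1 are disjoint; so ℓ - 2 ≤ k - 2t. Conversely, with t = u + 1 and k = 2u + s,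
-- the sets A_i = U ∪ {i} and B_i = V ∪ {i}, for disjoint u-sets U, V and i ranging
-- over the remaining s points, realise the crown of size s.
module Submission where

open import Defs
open import Data.Nat using (ℕ; zero; suc; z≤n; s≤s; _≤_; _+_; _∸_; _*_)
import Data.Nat.Properties as NP
open import Data.Nat.Solver using (module +-*-Solver)
open import Data.Bool using (true; false)
open import Data.Bool.Properties using () renaming (_≟_ to _≟B_)
open import Data.Fin as F using (Fin; _≟_)
import Data.Fin.Properties as FP
open import Data.Fin.Subset
open import Data.Fin.Subset.Properties
open import Data.Vec using ([]; _∷_; _++_; tail)
open import Data.Vec.Properties using (≡-dec; zipWith-++; ++-injectiveʳ)
open import Data.Product using (_×_; _,_; proj₁; proj₂)
open import Data.Sum using (inj₁; inj₂)
open import Relation.Nullary using (Dec; yes; no; contradiction)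
open import Relation.Nullary.Decidable using (decidable-stable)
open import Relation.Binary.PropositionalEquality
open import Function using (_∘_)
open import Function.Definitions using (Injective)

KG≡true⇒disjoint : ∀ {k t} (x y : TSubset k t) →
  KG k t x y ≡ true → proj₁ x ∩ proj₁ y ≡ ⊥
KG≡true⇒disjoint (x , _) (y , _) with ≡-dec _≟B_ (x ∩ y) ⊥
... | yes x∩y≡⊥ = λ _ → x∩y≡⊥
... | no _ = λ ()

KG≡false⇒meet : ∀ {k t} (x y : TSubset k t) →
  KG k t x y ≡ false → proj₁ x ∩ proj₁ y ≢ ⊥
KG≡false⇒meet (x , _) (y , _) with ≡-dec _≟B_ (x ∩ y) ⊥
... | yes _ = λ ()
... | no x∩y≢⊥ = λ _ → x∩y≢⊥

disjoint⇒KG≡true : ∀ {k t} (x y : TSubset k t) →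
  proj₁ x ∩ proj₁ y ≡ ⊥ → KG k t x y ≡ true
disjoint⇒KG≡true (x , _) (y , _) x∩y≡⊥ with ≡-dec _≟B_ (x ∩ y) ⊥
... | yes _ = refl
... | no x∩y≢⊥ = contradiction x∩y≡⊥ x∩y≢⊥

meet⇒KG≡false : ∀ {k t} (x y : TSubset k t) →
  proj₁ x ∩ proj₁ y ≢ ⊥ → KG k t x y ≡ false
meet⇒KG≡false (x , _) (y , _) x∩y≢⊥ with ≡-dec _≟B_ (x ∩ y) ⊥
... | yes x∩y≡⊥ = contradiction x∩y≡⊥ x∩y≢⊥
... | no _ = refl

crown-diagonal : ∀ {ℓ} (i : Fin ℓ) → crown ℓ i i ≡ false
crown-diagonal i with i ≟ i
... | yes _ = refl
... | no i≢i = contradiction refl i≢i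

crown-offDiagonal : ∀ {ℓ} {i j : Fin ℓ} → i ≢ j → crown ℓ i j ≡ true
crown-offDiagonal {i = i} {j} i≢j with i ≟ j
... | yes i≡j = contradiction i≡j i≢j
... | no _ = refl

≢⊥⇒Nonempty : ∀ {n} {p : Subset n} → p ≢ ⊥ → Nonempty p
≢⊥⇒Nonempty {p = p} p≢⊥ with nonempty? p
... | yes ne = ne
... | no ¬ne = contradiction (Empty-unique ¬ne) p≢⊥

disjoint⇒∉ : ∀ {n} {x : Fin n} {p q : Subset n} → p ∩ q ≡ ⊥ → x ∈ p → x ∉ q
disjoint⇒∉ p∩q≡⊥ x∈p x∈q = ∉⊥ (subst (_ ∈_) p∩q≡⊥ (x∈p∩q⁺ (x∈p , x∈q)))

disjoint⇒∣p∣+∣q∣≤∣p∪q∣ : ∀ {n} (p q : Subset n) → p ∩ q ≡ ⊥ → ∣ p ∣ + ∣ q ∣ ≤ ∣ p ∪ q ∣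
disjoint⇒∣p∣+∣q∣≤∣p∪q∣ [] [] _ = z≤n
disjoint⇒∣p∣+∣q∣≤∣p∪q∣ (true ∷ p) (true ∷ q) ()
disjoint⇒∣p∣+∣q∣≤∣p∪q∣ (true ∷ p) (false ∷ q) eq =
  s≤s (disjoint⇒∣p∣+∣q∣≤∣p∪q∣ p q (cong tail eq))
disjoint⇒∣p∣+∣q∣≤∣p∪q∣ (false ∷ p) (true ∷ q) eq =
  subst (_≤ suc ∣ p ∪ q ∣) (sym (NP.+-suc ∣ p ∣ ∣ q ∣))
        (s≤s (disjoint⇒∣p∣+∣q∣≤∣p∪q∣ p q (cong tail eq)))
disjoint⇒∣p∣+∣q∣≤∣p∪q∣ (false ∷ p) (false ∷ q) eq =
  disjoint⇒∣p∣+∣q∣≤∣p∪q∣ p q (cong tail eq)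

injective⇒≤∣p∣ : ∀ {m n} (p : Subset n) (f : Fin m → Fin n) →
  Injective _≡_ _≡_ f → (∀ i → f i ∈ p) → m ≤ ∣ p ∣
injective⇒≤∣p∣ {zero} p f _ _ = z≤n
injective⇒≤∣p∣ {suc m} p f f-inj f∈p = NP.≤-trans
  (s≤s (injective⇒≤∣p∣ (p - f F.zero) (f ∘ F.suc)
          (λ eq → FP.suc-injective (f-inj eq))
          (λ i → x∈p∧x≢y⇒x∈p-y (f∈p (F.suc i)) (λ eq → FP.0≢1+n (sym (f-inj eq))))))
  (x∈p⇒∣p-x∣<∣p∣ (f∈p F.zero))

∣p++q∣≡∣p∣+∣q∣ : ∀ {a b} (p : Subset a) (q : Subset b) → ∣ p ++ q ∣ ≡ ∣ p ∣ + ∣ q ∣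
∣p++q∣≡∣p∣+∣q∣ [] q = refl
∣p++q∣≡∣p∣+∣q∣ (true ∷ p) q = cong suc (∣p++q∣≡∣p∣+∣q∣ p q)
∣p++q∣≡∣p∣+∣q∣ (false ∷ p) q = ∣p++q∣≡∣p∣+∣q∣ p q

⊥++⊥≡⊥ : ∀ {a b} → ⊥ {a} ++ ⊥ {b} ≡ ⊥
⊥++⊥≡⊥ {zero} = refl
⊥++⊥≡⊥ {suc a} {b} = cong (false ∷_) (⊥++⊥≡⊥ {a} {b})

p≡⊥⇒⊥++p≡⊥ : ∀ {a b} {p : Subset b} → p ≡ ⊥ → ⊥ {a} ++ p ≡ ⊥
p≡⊥⇒⊥++p≡⊥ {a} refl = ⊥++⊥≡⊥ {a}

⊥++p≡⊥⇒p≡⊥ : ∀ {a b} {p : Subset b} → ⊥ {a} ++ p ≡ ⊥ → p ≡ ⊥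
⊥++p≡⊥⇒p≡⊥ {a} {b} eq = ++-injectiveʳ (⊥ {a}) ⊥ (trans eq (sym (⊥++⊥≡⊥ {a} {b})))

⁅x⁆∩⁅y⁆≡⊥ : ∀ {n} {x y : Fin n} → x ≢ y → ⁅ x ⁆ ∩ ⁅ y ⁆ ≡ ⊥
⁅x⁆∩⁅y⁆≡⊥ {y = y} x≢y = Empty-unique λ where
  (z , z∈⁅x⁆∩⁅y⁆) → let z∈⁅x⁆ , z∈⁅y⁆ = x∈p∩q⁻ _ _ z∈⁅x⁆∩⁅y⁆ in
    x≢y (trans (sym (x∈⁅y⁆⇒x≡y _ z∈⁅x⁆)) (x∈⁅y⁆⇒x≡y y z∈⁅y⁆))

record CrownFamily (k t ℓ : ℕ) : Set where
  field
    rows cols : Fin ℓ → Subset k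
    ∣rows∣ : ∀ i → ∣ rows i ∣ ≡ t
    ∣cols∣ : ∀ i → ∣ cols i ∣ ≡ t
    disjoint-offDiagonal : ∀ {i j} → i ≢ j → rows i ∩ cols j ≡ ⊥
    meet-diagonal : ∀ i → rows i ∩ cols i ≢ ⊥

HasCrownSubmatrix⇒CrownFamily : ∀ {k t ℓ} → HasCrownSubmatrix k t ℓ → CrownFamily k t ℓ
HasCrownSubmatrix⇒CrownFamily (r , c , _ , _ , entries) = record
  { rows = proj₁ ∘ r
  ; cols = proj₁ ∘ c
  ; ∣rows∣ = proj₂ ∘ r
  ; ∣cols∣ = proj₂ ∘ c
  ; disjoint-offDiagonal = λ {i} {j} i≢j →
      KG≡true⇒disjoint (r i) (c j) (trans (entries i j) (crown-offDiagonal i≢j))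
  ; meet-diagonal = λ i →
      KG≡false⇒meet (r i) (c i) (trans (entries i i) (crown-diagonal i))
  }

CrownFamily⇒HasCrownSubmatrix : ∀ {k t ℓ} → CrownFamily k t ℓ → HasCrownSubmatrix k t ℓ
CrownFamily⇒HasCrownSubmatrix {k} {t} {ℓ} F = r , c , r-injective , c-injective , entries
  where
  open CrownFamily F
  r c : Fin ℓ → TSubset k t
  r i = rows i , ∣rows∣ i
  c i = cols i , ∣cols∣ i

  entries : ∀ i j → KG k t (r i) (c j) ≡ crown ℓ i j
  entries i j = case-split (i ≟ j)
    where
    case-split : Dec (i ≡ j) → KG k t (r i) (c j) ≡ crown ℓ i j
    case-split (yes refl) = trans (meet⇒KG≡false (r i) (c i) (meet-diagonal i)) (sym (crown-diagonal i))
    case-split (no i≢j) = trans (disjoint⇒KG≡true (r i) (c j) (disjoint-offDiagonal i≢j))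
                                (sym (crown-offDiagonal i≢j))

  r-injective : Injective _≡_ _≡_ r
  r-injective {i} {j} ri≡rj = decidable-stable (i ≟ j) λ i≢j →
    meet-diagonal j (subst (λ A → A ∩ cols j ≡ ⊥) (cong proj₁ ri≡rj) (disjoint-offDiagonal i≢j))

  c-injective : Injective _≡_ _≡_ c
  c-injective {i} {j} ci≡cj = decidable-stable (i ≟ j) λ i≢j →
    meet-diagonal i (subst (λ B → rows i ∩ B ≡ ⊥) (sym (cong proj₁ ci≡cj)) (disjoint-offDiagonal i≢j))

module _ {k t ℓ} (F : CrownFamily k t ℓ) where
  open CrownFamily F

  diagonalPoint : Fin ℓ → Fin k
  diagonalPoint i = proj₁ (≢⊥⇒Nonempty (meet-diagonal i))

  diagonalPoint∈rows×cols : ∀ i → diagonalPoint i ∈ rows i × diagonalPoint i ∈ cols i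
  diagonalPoint∈rows×cols i = x∈p∩q⁻ (rows i) (cols i) (proj₂ (≢⊥⇒Nonempty (meet-diagonal i)))

  diagonalPoint-injective : Injective _≡_ _≡_ diagonalPoint
  diagonalPoint-injective {i} {j} xi≡xj = decidable-stable (i ≟ j) λ i≢j →
    disjoint⇒∉ (disjoint-offDiagonal i≢j) (proj₁ (diagonalPoint∈rows×cols i))
      (subst (_∈ cols j) (sym xi≡xj) (proj₂ (diagonalPoint∈rows×cols j)))

  diagonalPoint∉rows∪cols : ∀ {i j m} → i ≢ m → m ≢ j → diagonalPoint m ∉ rows i ∪ cols j
  diagonalPoint∉rows∪cols {i} {j} {m} i≢m m≢j x∈rows∪cols with x∈p∪q⁻ (rows i) (cols j) x∈rows∪cols
  ... | inj₁ x∈rows = disjoint⇒∉ (disjoint-offDiagonal i≢m) x∈rows (proj₂ (diagonalPoint∈rows×cols m))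
  ... | inj₂ x∈cols = disjoint⇒∉ (disjoint-offDiagonal m≢j) (proj₁ (diagonalPoint∈rows×cols m)) x∈cols

CrownFamily-size : ∀ {k t m} → CrownFamily k t (2 + m) → m ≤ k ∸ 2 * t
CrownFamily-size {k} {t} {m} F = begin
  m             ≤⟨ injective⇒≤∣p∣ (∁ D) outerPoint outerPoint-injective outerPoint∈∁D ⟩
  ∣ ∁ D ∣        ≡⟨ ∣∁p∣≡n∸∣p∣ D ⟩
  k ∸ ∣ D ∣      ≤⟨ NP.∸-monoʳ-≤ k 2t≤∣D∣ ⟩
  k ∸ 2 * t     ∎
  where
  open NP.≤-Reasoning
  open CrownFamily F
  0F 1F : Fin (2 + m)
  0F = F.zero
  1F = F.suc F.zero

  D : Subset k
  D = rows 0F ∪ cols 1F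

  2t≤∣D∣ : 2 * t ≤ ∣ D ∣
  2t≤∣D∣ = begin
    2 * t                     ≡⟨ cong (t +_) (NP.+-identityʳ t) ⟩
    t + t                     ≡⟨ sym (cong₂ _+_ (∣rows∣ 0F) (∣cols∣ 1F)) ⟩
    ∣ rows 0F ∣ + ∣ cols 1F ∣  ≤⟨ disjoint⇒∣p∣+∣q∣≤∣p∪q∣ (rows 0F) (cols 1F) (disjoint-offDiagonal λ ()) ⟩
    ∣ D ∣                     ∎

  outerPoint : Fin m → Fin k
  outerPoint i = diagonalPoint F (F.suc (F.suc i))

  outerPoint-injective : Injective _≡_ _≡_ outerPoint
  outerPoint-injective eq = FP.suc-injective (FP.suc-injective (diagonalPoint-injective F eq))

  outerPoint∈∁D : ∀ i → outerPoint i ∈ ∁ D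
  outerPoint∈∁D i = x∉p⇒x∈∁p (diagonalPoint∉rows∪cols F (λ ()) (λ ()))

CrownFamily⇒≤ : ∀ {k t ℓ} → CrownFamily k t ℓ → ℓ ≤ k ∸ 2 * t + 2
CrownFamily⇒≤ {ℓ = zero} _ = z≤n
CrownFamily⇒≤ {k} {t} {suc zero} _ = NP.≤-trans (s≤s z≤n) (NP.m≤n+m 2 (k ∸ 2 * t))
CrownFamily⇒≤ {k} {t} {suc (suc m)} F =
  NP.≤-trans (NP.≤-reflexive (NP.+-comm 2 m)) (NP.+-monoˡ-≤ 2 (CrownFamily-size F))

module _ (u s : ℕ) where
  rowSet colSet : Fin s → Subset (u + (u + s))
  rowSet i = ⊤ {u} ++ (⊥ {u} ++ ⁅ i ⁆)
  colSet i = ⊥ {u} ++ (⊤ {u} ++ ⁅ i ⁆)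

  rowSet∩colSet : ∀ i j → rowSet i ∩ colSet j ≡ ⊥ {u} ++ (⊥ {u} ++ (⁅ i ⁆ ∩ ⁅ j ⁆))
  rowSet∩colSet i j = begin
    rowSet i ∩ colSet j
      ≡⟨ zipWith-++ _ (⊤ {u}) (⊥ {u} ++ ⁅ i ⁆) (⊥ {u}) (⊤ {u} ++ ⁅ j ⁆) ⟩
    (⊤ {u} ∩ ⊥) ++ ((⊥ {u} ++ ⁅ i ⁆) ∩ (⊤ {u} ++ ⁅ j ⁆))
      ≡⟨ cong₂ _++_ (∩-zeroʳ (⊤ {u})) (zipWith-++ _ (⊥ {u}) ⁅ i ⁆ (⊤ {u}) ⁅ j ⁆) ⟩
    ⊥ {u} ++ ((⊥ {u} ∩ ⊤) ++ (⁅ i ⁆ ∩ ⁅ j ⁆))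
      ≡⟨ cong (λ p → ⊥ {u} ++ (p ++ (⁅ i ⁆ ∩ ⁅ j ⁆))) (∩-zeroˡ (⊤ {u})) ⟩
    ⊥ {u} ++ (⊥ {u} ++ (⁅ i ⁆ ∩ ⁅ j ⁆)) ∎
    where open ≡-Reasoning

  ∣p++q++⁅i⁆∣≡1+u : ∀ (p q : Subset u) → ∣ p ∣ + ∣ q ∣ ≡ u →
                    (i : Fin s) → ∣ p ++ (q ++ ⁅ i ⁆) ∣ ≡ suc u
  ∣p++q++⁅i⁆∣≡1+u p q ∣p∣+∣q∣≡u i = begin
    ∣ p ++ (q ++ ⁅ i ⁆) ∣           ≡⟨ ∣p++q∣≡∣p∣+∣q∣ p (q ++ ⁅ i ⁆) ⟩
    ∣ p ∣ + ∣ q ++ ⁅ i ⁆ ∣          ≡⟨ cong (∣ p ∣ +_) (∣p++q∣≡∣p∣+∣q∣ q ⁅ i ⁆) ⟩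
    ∣ p ∣ + (∣ q ∣ + ∣ ⁅ i ⁆ ∣)     ≡⟨ cong (λ n → ∣ p ∣ + (∣ q ∣ + n)) (∣⁅x⁆∣≡1 i) ⟩
    ∣ p ∣ + (∣ q ∣ + 1)             ≡⟨ sym (NP.+-assoc ∣ p ∣ ∣ q ∣ 1) ⟩
    ∣ p ∣ + ∣ q ∣ + 1               ≡⟨ cong (_+ 1) ∣p∣+∣q∣≡u ⟩
    u + 1                          ≡⟨ NP.+-comm u 1 ⟩
    suc u                          ∎
    where open ≡-Reasoning

  standardCrownFamily : CrownFamily (u + (u + s)) (suc u) s
  standardCrownFamily = record
    { rows = rowSet
    ; cols = colSet
    ; ∣rows∣ = ∣p++q++⁅i⁆∣≡1+u ⊤ ⊥ (trans (cong₂ _+_ (∣⊤∣≡n u) (∣⊥∣≡0 u)) (NP.+-identityʳ u))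
    ; ∣cols∣ = ∣p++q++⁅i⁆∣≡1+u ⊥ ⊤ (cong₂ _+_ (∣⊥∣≡0 u) (∣⊤∣≡n u))
    ; disjoint-offDiagonal = λ {i} {j} i≢j → trans (rowSet∩colSet i j)
        (p≡⊥⇒⊥++p≡⊥ {u} (p≡⊥⇒⊥++p≡⊥ {u} (⁅x⁆∩⁅y⁆≡⊥ i≢j)))
    ; meet-diagonal = λ i rowSet∩colSet≡⊥ →
        let ⁅i⁆∩⁅i⁆≡⊥ = ⊥++p≡⊥⇒p≡⊥ {u} (⊥++p≡⊥⇒p≡⊥ {u}
                          (trans (sym (rowSet∩colSet i i)) rowSet∩colSet≡⊥))
        in ∉⊥ (subst (i ∈_) (trans (sym (∩-idem ⁅ i ⁆)) ⁅i⁆∩⁅i⁆≡⊥) (x∈⁅x⁆ i))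
    }

corollary1 : (t k : ℕ) → 1 ≤ t → 2 * t ≤ k →
    HasCrownSubmatrix k t (k ∸ 2 * t + 2)
    × (∀ ℓ → HasCrownSubmatrix k t ℓ → ℓ ≤ k ∸ 2 * t + 2)
corollary1 (suc u) k _ 2t≤k =
    subst (λ n → HasCrownSubmatrix n (suc u) s) (sym k≡u+[u+s])
      (CrownFamily⇒HasCrownSubmatrix (standardCrownFamily u s))
  , λ ℓ → CrownFamily⇒≤ ∘ HasCrownSubmatrix⇒CrownFamily
  where
  open +-*-Solver
  s : ℕ
  s = k ∸ 2 * suc u + 2
  k≡u+[u+s] : k ≡ u + (u + s)
  k≡u+[u+s] = trans (sym (NP.m∸n+n≡m 2t≤k))
    (solve 2 (λ u d → d :+ con 2 :* (con 1 :+ u) := u :+ (u :+ (d :+ con 2))) refl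
           u (k ∸ 2 * suc u))
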